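{- Let $n,r\ge1$. The set of monomials $$\Big\{\prod_{l=1}^r m(\mathcal{R}_l)^l : \mathcal{R}_l\subseteq[n]\times[n] \ (1\le l\le r),\ \mathcal{R}=\bigcup_{l=1}^r\mathcal{R}_l \text{ is a rook placement}\Big\}$$ descends to a spanning set of $\mathbb{C}[\mathbf{x}_{n\times n}]/I_{\mathfrak{S}_{n,r}}$.
   Context: $\mathbb{C}[\mathbf{x}_{n\times n}]$ is the polynomial ring in variables $x_{i,j}$, $1\le i,j\le n$. $I_{\mathfrak{S}_{n,r}}$ is the ideal generated by: $x_{i,j}^{r+1}$ for all $i,j$; $x_{i,j}x_{i,j'}$ for all $i$ and $j<j'$; $x_{i,j}x_{i',j}$ for all $j$ and $i<i'$; $\sum_{j=1}^n x_{i,j}^r$ for each $i$; $\sum_{i=1}^n x_{i,j}^r$ for each $j$. For $S\subseteq[n]\times[n]$, $m(S)=\prod_{(i,j)\in S}x_{i,j}$. A rook placement is a subset of $[n]\times[n]$ with no two points sharing a first or a second coordinate. -}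

module Defs where

open import Level using (Level; _⊔_)
open import Algebra.Bundles using (CommutativeRing)
open import Data.Nat as ℕ using (ℕ; zero; suc)
open import Data.Fin using (Fin; toℕ)
open import Data.Bool using (Bool; true; false; if_then_else_)
open import Data.List using (List; []; _∷_; map; foldr; concatMap)
open import Data.List.Relation.Unary.All using (All)
open import Data.Product using (_×_; _,_; Σ; ∃; proj₁; proj₂)
open import Relation.Nullary using (¬_; Dec; yes; no)
open import Relation.Nullary.Decidable using (⌊_⌋)
open import Relation.Binary.PropositionalEquality using (_≡_)
open import Data.Fin.Properties using (all?)
import Data.Nat.Properties as ℕP

sumFin : (k : ℕ) → (Fin k → ℕ) → ℕ
sumFin zero    f = 0
sumFin (suc k) f = f Data.Fin.zero ℕ.+ sumFin k (λ i → f (Data.Fin.suc i))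

record IsFieldRing {c ℓ : Level} (R : CommutativeRing c ℓ) : Set (c ⊔ ℓ) where
  open CommutativeRing R
  field
    0≉1     : ¬ (0# ≈ 1#)
    inverse : ∀ x → ¬ (x ≈ 0#) → Σ Carrier λ y → x * y ≈ 1#

-- Exponent vectors for the variables x_{i,j}, (i,j) ∈ [n]×[n] (0-indexed by Fin n).
Mono : ℕ → Set
Mono n = Fin n → Fin n → ℕ

monoEq? : ∀ {n} (a b : Mono n) → Dec (∀ i j → a i j ≡ b i j)
monoEq? a b = all? λ i → all? λ j → a i j ℕP.≟ b i j

monoMul : ∀ {n} → Mono n → Mono n → Mono n
monoMul a b i j = a i j ℕ.+ b i j

varPow : ∀ {n} → Fin n → Fin n → ℕ → Mono n
varPow {n} i j k i' j' =
  if ⌊ i Data.Fin.≟ i' ⌋ then (if ⌊ j Data.Fin.≟ j' ⌋ then k else 0) else 0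

module Poly {c ℓ : Level} (R : CommutativeRing c ℓ) (n : ℕ) where
  open CommutativeRing R

  -- A polynomial in ℂ[x_{n×n}] (coefficients in R) is a finite formal sum of terms.
  Poly : Set c
  Poly = List (Carrier × Mono n)

  coeff : Poly → Mono n → Carrier
  coeff []             μ = 0#
  coeff ((a , e) ∷ p)  μ = (if ⌊ monoEq? e μ ⌋ then a else 0#) + coeff p μ

  _≃_ : Poly → Poly → Set ℓ
  p ≃ q = ∀ μ → coeff p μ ≈ coeff q μ

  _⊕_ : Poly → Poly → Poly
  _⊕_ = Data.List._++_

  _⊗_ : Poly → Poly → Poly
  p ⊗ q = concatMap (λ { (a , e) → map (λ { (b , f) → (a * b , monoMul e f) }) q }) p

  monoP : Mono n → Poly
  monoP e = (1# , e) ∷ []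

  scale : Carrier → Poly → Poly
  scale a p = map (λ { (b , e) → (a * b , e) }) p

  sumP : List Poly → Poly
  sumP = foldr _⊕_ []

  data Gen (r : ℕ) : Poly → Set c where
    powGen : ∀ i j → Gen r (monoP (varPow i j (suc r)))
    rowGen : ∀ i j j' → toℕ j ℕ.< toℕ j' →
             Gen r (monoP (monoMul (varPow i j 1) (varPow i j' 1)))
    colGen : ∀ j i i' → toℕ i ℕ.< toℕ i' →
             Gen r (monoP (monoMul (varPow i j 1) (varPow i' j 1)))
    rowSum : ∀ i → Gen r (Data.List.tabulate {n = n} λ j → (1# , varPow i j r))
    colSum : ∀ j → Gen r (Data.List.tabulate {n = n} λ i → (1# , varPow i j r))

  InIdeal : ℕ → Poly → Set (c ⊔ ℓ)
  InIdeal r p = Σ (List (Poly × Poly)) λ gs →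
                  All (λ gh → Gen r (proj₂ gh)) gs ×
                  (p ≃ sumP (map (λ gh → proj₁ gh ⊗ proj₂ gh) gs))

-- A family (R_1, …, R_r) of subsets of [n]×[n]; R_l is indexed by l-1 : Fin r.
SubsetFamily : ℕ → ℕ → Set
SubsetFamily n r = Fin r → Fin n → Fin n → Bool

InUnion : ∀ {n r} → SubsetFamily n r → Fin n → Fin n → Set
InUnion {r = r} 𝓡 i j = Σ (Fin r) λ l → 𝓡 l i j ≡ true

IsRookPlacement : ∀ {n} → (Fin n → Fin n → Set) → Set
IsRookPlacement S =
  (∀ i j j' → S i j → S i j' → j ≡ j') ×
  (∀ i i' j → S i j → S i' j → i ≡ i')

-- Exponent vector of ∏_{l=1}^r m(R_l)^l.
familyMono : ∀ {n r} → SubsetFamily n r → Mono n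
familyMono {r = r} 𝓡 i j =
  sumFin r λ l → if 𝓡 l i j then suc (toℕ l) else 0

-- A monomial x^e is either divisible by one of the monomial generators
-- x_{ij}^{r+1}, x_{ij} x_{ij'}, x_{ij} x_{i'j}, and then lies in the ideal, or all
-- its exponents are at most r and its support is a rook placement; in the latter
-- case x^e = ∏_l m(ℛ_l)^l where ℛ_l is the set of positions carrying exponent l.
-- Sorting the terms of a polynomial accordingly gives the decomposition.
module Submission where

open import Defs
open import Level using (Level; _⊔_)
open import Algebra.Bundles using (CommutativeRing)
open import Data.Nat using (ℕ; zero; suc; _+_; _≤_; _<_; _∸_; z≤n; s≤s; _≟_; _≤?_; _<?_)
open import Data.Nat.Properties using (suc-injective; ≮⇒≥; <-cmp; <-irrefl; +-identityʳ; m∸n+n≡m)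
open import Data.Fin using (Fin; toℕ; fromℕ<) renaming (_≟_ to _≟ᶠ_)
open import Data.Fin.Properties as Finₚ using (any?; toℕ-injective; toℕ-fromℕ<)
open import Data.Bool using (if_then_else_)
open import Data.List using (List; []; _∷_; map)
open import Data.List.Relation.Unary.All using (All; []; _∷_)
open import Data.Product using (_×_; _,_; Σ; ∃; proj₁; proj₂)
open import Data.Sum using (_⊎_; inj₁; inj₂)
open import Data.Empty using (⊥-elim)
open import Function using (_∘_)
open import Relation.Binary.Definitions using (tri<; tri≈; tri>)
open import Relation.Nullary using (¬_; Dec; yes; no)
open import Relation.Nullary.Decidable using (⌊_⌋; _×-dec_)
open import Relation.Unary using (Decidable)
open import Relation.Binary.PropositionalEquality as ≡
  using (_≡_; _≢_; refl; cong; cong₂; subst; module ≡-Reasoning)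

sumFin-≡0 : ∀ k (f : Fin k → ℕ) → (∀ l → f l ≡ 0) → sumFin k f ≡ 0
sumFin-≡0 zero    f f≡0 = refl
sumFin-≡0 (suc k) f f≡0 = cong₂ _+_ (f≡0 Fin.zero) (sumFin-≡0 k (f ∘ Fin.suc) (f≡0 ∘ Fin.suc))

sumFin-single : ∀ k (f : Fin k → ℕ) l₀ → (∀ l → l ≢ l₀ → f l ≡ 0) → sumFin k f ≡ f l₀
sumFin-single (suc k) f Fin.zero f≡0 = begin
  f Fin.zero + sumFin k (f ∘ Fin.suc) ≡⟨ cong (f Fin.zero +_) (sumFin-≡0 k _ λ l → f≡0 (Fin.suc l) λ ()) ⟩
  f Fin.zero + 0                      ≡⟨ +-identityʳ _ ⟩
  f Fin.zero                          ∎
  where open ≡-Reasoning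
sumFin-single (suc k) f (Fin.suc l₀) f≡0 =
  cong₂ _+_ (f≡0 Fin.zero λ ())
            (sumFin-single k (f ∘ Fin.suc) l₀ λ l l≢l₀ → f≡0 (Fin.suc l) (l≢l₀ ∘ Finₚ.suc-injective))

levelWeight : ∀ {r} → ℕ → Fin r → ℕ
levelWeight v l = if ⌊ v ≟ suc (toℕ l) ⌋ then suc (toℕ l) else 0

sumFin-levelWeight : ∀ {r} v → v ≤ r → sumFin r (levelWeight v) ≡ v
sumFin-levelWeight {r} zero    _   = sumFin-≡0 r _ λ _ → refl
sumFin-levelWeight {r} (suc w) w<r = begin
  sumFin r (levelWeight (suc w)) ≡⟨ sumFin-single r _ l₀ off ⟩
  levelWeight (suc w) l₀         ≡⟨ on ⟩
  suc w                          ∎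
  where
  open ≡-Reasoning
  l₀ : Fin r
  l₀ = fromℕ< w<r

  off : ∀ l → l ≢ l₀ → levelWeight (suc w) l ≡ 0
  off l l≢l₀ with suc w ≟ suc (toℕ l)
  ... | no  _   = refl
  ... | yes w≡l = ⊥-elim (l≢l₀ (toℕ-injective (≡.trans (suc-injective (≡.sym w≡l)) (≡.sym (toℕ-fromℕ< w<r)))))

  on : levelWeight (suc w) l₀ ≡ suc w
  on with suc w ≟ suc (toℕ l₀)
  ... | yes _   = cong suc (toℕ-fromℕ< w<r)
  ... | no  w≢l = ⊥-elim (w≢l (cong suc (≡.sym (toℕ-fromℕ< w<r))))

AscendingPair : ∀ {n} → (Fin n → Set) → Set
AscendingPair P = ∃ λ a → ∃ λ b → toℕ a < toℕ b × P a × P b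

ascendingPair? : ∀ {n} {P : Fin n → Set} → Decidable P → Dec (AscendingPair P)
ascendingPair? P? = any? λ a → any? λ b → (toℕ a <? toℕ b) ×-dec P? a ×-dec P? b

¬ascendingPair⇒atMostOne : ∀ {n} {P : Fin n → Set} → ¬ AscendingPair P →
  ∀ a b → P a → P b → a ≡ b
¬ascendingPair⇒atMostOne ¬pair a b pa pb with <-cmp (toℕ a) (toℕ b)
... | tri< a<b _ _ = ⊥-elim (¬pair (a , b , a<b , pa , pb))
... | tri≈ _ a≡b _ = toℕ-injective a≡b
... | tri> _ _ b<a = ⊥-elim (¬pair (b , a , b<a , pb , pa))

IsRookPlacement-⊆ : ∀ {n} {S T : Fin n → Fin n → Set} →
  (∀ {i j} → S i j → T i j) → IsRookPlacement T → IsRookPlacement S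
IsRookPlacement-⊆ S⊆T (rows , cols) =
  (λ i j j' s s' → rows i j j' (S⊆T s) (S⊆T s')) ,
  (λ i i' j s s' → cols i i' j (S⊆T s) (S⊆T s'))

_≐_ : ∀ {n} → Mono n → Mono n → Set
a ≐ b = ∀ i j → a i j ≡ b i j

_∣ₘ_ : ∀ {n} → Mono n → Mono n → Set
m ∣ₘ e = ∀ i j → m i j ≤ e i j

Support : ∀ {n} → Mono n → Fin n → Fin n → Set
Support e i j = 1 ≤ e i j

varPow-∣ₘ : ∀ {n} {e : Mono n} {i j k} → k ≤ e i j → varPow i j k ∣ₘ e
varPow-∣ₘ {i = i} {j} k≤e a b with i ≟ᶠ a | j ≟ᶠ b
... | yes refl | yes refl = k≤e
... | yes refl | no  _    = z≤n
... | no  _    | _        = z≤n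

varPow-pair-∣ₘ : ∀ {n} {e : Mono n} {i j i' j'} → ¬ (i ≡ i' × j ≡ j') →
  Support e i j → Support e i' j' → monoMul (varPow i j 1) (varPow i' j' 1) ∣ₘ e
varPow-pair-∣ₘ {i = i} {j} {i'} {j'} distinct s s' a b
  with i ≟ᶠ a | j ≟ᶠ b | i' ≟ᶠ a | j' ≟ᶠ b
... | yes refl | yes refl | yes refl | yes refl = ⊥-elim (distinct (refl , refl))
... | yes refl | yes refl | yes refl | no  _    = s
... | yes refl | yes refl | no  _    | _        = s
... | yes refl | no  _    | yes refl | yes refl = s'
... | yes refl | no  _    | yes refl | no  _    = z≤n
... | yes refl | no  _    | no  _    | _        = z≤n
... | no  _    | _        | yes refl | yes refl = s'
... | no  _    | _        | yes refl | no  _    = z≤n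
... | no  _    | _        | no  _    | _        = z≤n

module Spanning {c ℓ : Level} (K : CommutativeRing c ℓ) (n r : ℕ) where
  open CommutativeRing K renaming (refl to ≈-refl)
  open Poly K n
  open import Algebra.Properties.CommutativeSemigroup +-commutativeSemigroup using (x∙yz≈y∙xz)

  ∷-cong : ∀ {a a' e e'} p q → a ≈ a' → e ≐ e' → p ≃ q → ((a , e) ∷ p) ≃ ((a' , e') ∷ q)
  ∷-cong {a} {a'} {e} {e'} p q a≈a' e≐e' p≃q μ = +-cong leading (p≃q μ)
    where
    leading : (if ⌊ monoEq? e μ ⌋ then a else 0#) ≈ (if ⌊ monoEq? e' μ ⌋ then a' else 0#)
    leading with monoEq? e μ | monoEq? e' μ
    ... | yes _    | yes _     = a≈a'
    ... | no  _    | no  _     = ≈-refl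
    ... | yes e≐μ  | no  e'≠μ  = ⊥-elim (e'≠μ λ i j → ≡.trans (≡.sym (e≐e' i j)) (e≐μ i j))
    ... | no  e≠μ  | yes e'≐μ  = ⊥-elim (e≠μ λ i j → ≡.trans (e≐e' i j) (e'≐μ i j))

  ∷-⊕ : ∀ t p q → (t ∷ (p ⊕ q)) ≃ (p ⊕ (t ∷ q))
  ∷-⊕ t []      q μ = ≈-refl
  ∷-⊕ t (s ∷ p) q μ = trans (x∙yz≈y∙xz _ _ _) (+-cong ≈-refl (∷-⊕ t p q μ))

  Standard : Mono n → Set
  Standard e = (∀ i j → e i j ≤ r) × IsRookPlacement (Support e)

  Reducible : Mono n → Set c
  Reducible e = Σ (Mono n) λ m → Gen r (monoP m) × m ∣ₘ e

  bounded⊎reducible : ∀ e → (∀ i j → e i j ≤ r) ⊎ Reducible e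
  bounded⊎reducible e with any? (λ i → any? λ j → suc r ≤? e i j)
  ... | yes (i , j , r<e) = inj₂ (_ , powGen i j , varPow-∣ₘ r<e)
  ... | no  ¬r<e          = inj₁ λ i j → ≮⇒≥ λ r<e → ¬r<e (i , j , r<e)

  rowsAtMostOne⊎reducible : ∀ e →
    (∀ i j j' → Support e i j → Support e i j' → j ≡ j') ⊎ Reducible e
  rowsAtMostOne⊎reducible e with any? (λ i → ascendingPair? λ j → 1 ≤? e i j)
  ... | yes (i , j , j' , j<j' , s , s') =
        inj₂ (_ , rowGen i j j' j<j' , varPow-pair-∣ₘ (λ (_ , j≡j') → <-irrefl (cong toℕ j≡j') j<j') s s')
  ... | no ¬pair = inj₁ λ i → ¬ascendingPair⇒atMostOne λ pair → ¬pair (i , pair)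

  colsAtMostOne⊎reducible : ∀ e →
    (∀ i i' j → Support e i j → Support e i' j → i ≡ i') ⊎ Reducible e
  colsAtMostOne⊎reducible e with any? (λ j → ascendingPair? λ i → 1 ≤? e i j)
  ... | yes (j , i , i' , i<i' , s , s') =
        inj₂ (_ , colGen j i i' i<i' , varPow-pair-∣ₘ (λ (i≡i' , _) → <-irrefl (cong toℕ i≡i') i<i') s s')
  ... | no ¬pair = inj₁ λ i i' j → ¬ascendingPair⇒atMostOne (λ pair → ¬pair (j , pair)) i i'

  standard⊎reducible : ∀ e → Standard e ⊎ Reducible e
  standard⊎reducible e
    with bounded⊎reducible e | rowsAtMostOne⊎reducible e | colsAtMostOne⊎reducible e
  ... | inj₁ bounded | inj₁ rows | inj₁ cols = inj₁ (bounded , rows , cols)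
  ... | inj₂ red     | _         | _         = inj₂ red
  ... | inj₁ _       | inj₂ red  | _         = inj₂ red
  ... | inj₁ _       | inj₁ _    | inj₂ red  = inj₂ red

  levelSets : Mono n → SubsetFamily n r
  levelSets e l i j = ⌊ e i j ≟ suc (toℕ l) ⌋

  levelSets-⊆-support : ∀ e {i j} → InUnion (levelSets e) i j → Support e i j
  levelSets-⊆-support e {i} {j} (l , _) with e i j ≟ suc (toℕ l)
  levelSets-⊆-support e (l , _)  | yes e≡l = subst (1 ≤_) (≡.sym e≡l) (s≤s z≤n)
  levelSets-⊆-support e (l , ()) | no  _

  familyMono-levelSets : ∀ {e} → (∀ i j → e i j ≤ r) → familyMono (levelSets e) ≐ e
  familyMono-levelSets {e} bounded i j = sumFin-levelWeight (e i j) (bounded i j)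

  standardTerm : Carrier × SubsetFamily n r → Poly
  standardTerm t = scale (proj₁ t) (monoP (familyMono (proj₂ t)))

  SpannedModIdeal : Poly → Set (c ⊔ ℓ)
  SpannedModIdeal p = Σ (List (Carrier × SubsetFamily n r)) λ cs →
    All (λ t → IsRookPlacement (InUnion (proj₂ t))) cs ×
    Σ Poly λ q → InIdeal r q × p ≃ (sumP (map standardTerm cs) ⊕ q)

  InIdeal-∷ : ∀ {a e q} → Reducible e → InIdeal r q → InIdeal r ((a , e) ∷ q)
  InIdeal-∷ {a} {e} {q} (m , gen , m∣e) (gs , gens , q≃) =
    ((a , (λ i j → e i j ∸ m i j)) ∷ [] , monoP m) ∷ gs , gen ∷ gens ,
    ∷-cong q (sumP (map (λ gh → proj₁ gh ⊗ proj₂ gh) gs))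
      (sym (*-identityʳ a)) (λ i j → ≡.sym (m∸n+n≡m (m∣e i j))) q≃

  spanned-∷-standard : ∀ {a e p} → Standard e → SpannedModIdeal p → SpannedModIdeal ((a , e) ∷ p)
  spanned-∷-standard {a} {e} {p} (bounded , rook) (cs , rooks , q , q∈I , p≃) =
    (a , levelSets e) ∷ cs ,
    IsRookPlacement-⊆ (levelSets-⊆-support e) rook ∷ rooks ,
    q , q∈I ,
    ∷-cong p (sumP (map standardTerm cs) ⊕ q)
      (sym (*-identityʳ a)) (λ i j → ≡.sym (familyMono-levelSets bounded i j)) p≃

  spanned-∷-reducible : ∀ {a e p} → Reducible e → SpannedModIdeal p → SpannedModIdeal ((a , e) ∷ p)
  spanned-∷-reducible {a} {e} {p} red (cs , rooks , q , q∈I , p≃) =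
    cs , rooks , (a , e) ∷ q , InIdeal-∷ {q = q} red q∈I ,
    λ μ → trans (∷-cong p (S ⊕ q) ≈-refl (λ _ _ → refl) p≃ μ) (∷-⊕ (a , e) S q μ)
    where S = sumP (map standardTerm cs)

  spanned : ∀ p → SpannedModIdeal p
  spanned []            = [] , [] , [] , ([] , [] , λ _ → ≈-refl) , λ _ → ≈-refl
  spanned ((a , e) ∷ p) with standard⊎reducible e
  ... | inj₁ std = spanned-∷-standard {p = p} std (spanned p)
  ... | inj₂ red = spanned-∷-reducible {p = p} red (spanned p)

lemma3p18 : ∀ {c ℓ : Level} (K : CommutativeRing c ℓ) → IsFieldRing K →
    (n r : ℕ) → 1 ≤ n → 1 ≤ r →
    (p : Poly.Poly K n) →
    Σ (List (CommutativeRing.Carrier K × SubsetFamily n r)) λ cs →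
      All (λ t → IsRookPlacement (InUnion (proj₂ t))) cs ×
      Σ (Poly.Poly K n) λ q →
        Poly.InIdeal K n r q ×
        Poly._≃_ K n p
          (Poly._⊕_ K n
            (Poly.sumP K n (map (λ t → Poly.scale K n (proj₁ t) (Poly.monoP K n (familyMono (proj₂ t)))) cs))
            q)
lemma3p18 K _ n r _ _ = Spanning.spanned K n r
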